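{- Let $t\ge 3$ and $1\le i\le t-2$. Then $F(i)$ is isomorphic (as a digraph) to $F(i+1)\sqcup F'(i+1)$, the digraph obtained from the disjoint union of $F(i+1)$ and a disjoint isomorphic copy $F'(i+1)$ of $F(i+1)$ (with vertex $v_{i+1}^{a_1\cdots a_m}$ corresponding to $u_{i+1}^{a_1\cdots a_m}$) by adding the single arc $(u_{i+1},v_{i+1})$.
   Context: Fix an integer $t\ge 3$. Let $F_t$ be the digraph whose vertices are the formal symbols $u_i^{a_1a_2\cdots a_m}$ with $1\le i\le t-1$, $m\ge 0$, $a_1,\dots,a_m$ positive integers, and $i+a_1+\cdots+a_m\le t-1$ (for $m=0$ the symbol is $u_i$), and whose arcs are all pairs $(u_i^{a_1\cdots a_m},\,u_i^{a_1\cdots a_m j})$ where $j$ is a positive integer with $i+a_1+\cdots+a_m+j\le t-1$. For $1\le i\le t-1$, $F(i)$ denotes the connected component of $F_t$ containing $u_i$, i.e. the subdigraph on all symbols with subscript $i$. $F'(i)$ is a disjoint copy of $F(i)$ whose vertices are $v_i^{a_1\cdots a_m}$ in correspondence with $u_i^{a_1\cdots a_m}$. -}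

module Defs where

open import Level using (0ℓ)
open import Data.Nat using (ℕ; _+_; _∸_; _≤_)
open import Data.List using (List; []; _∷_; _++_; [_])
open import Data.Nat.ListAction using (sum)
open import Data.List.Relation.Unary.All using (All)
open import Data.Product using (Σ; ∃; _×_; _,_; proj₁)
open import Data.Sum using (_⊎_; inj₁; inj₂)
open import Data.Empty using (⊥)
open import Function.Bundles using (_↔_; Inverse; _⇔_)
open import Relation.Binary.PropositionalEquality using (_≡_)

record Digraph : Set₁ where
  field
    Vertex : Set
    Arc    : Vertex → Vertex → Set
open Digraph public

record _≅_ (G H : Digraph) : Set where
  field
    bij      : Vertex G ↔ Vertex H
    arc-pres : ∀ x y → Arc G x y ⇔ Arc H (Inverse.to bij x) (Inverse.to bij y)

-- Vertices of F(i) (for parameter t): the symbol u_i^{a_1...a_m} is encoded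
-- by the list a = a_1 ... a_m of positive integers with i + a_1 + ... + a_m ≤ t - 1.
record FVertex (t i : ℕ) : Set where
  constructor fv
  field
    word  : List ℕ
    pos   : All (λ a → 1 ≤ a) word
    bound : i + sum word ≤ t ∸ 1
open FVertex public

-- Arc (u_i^{a}, u_i^{a j}) with j positive (the bound i + Σa + j ≤ t-1
-- is the membership condition of the target vertex).
FArc : (t i : ℕ) → FVertex t i → FVertex t i → Set
FArc t i x y = Σ ℕ λ j → 1 ≤ j × word y ≡ word x ++ [ j ]

F : (t i : ℕ) → Digraph
F t i = record { Vertex = FVertex t i ; Arc = FArc t i }

IsRoot : ∀ {t i} → FVertex t i → Set
IsRoot x = word x ≡ []

-- G ⊔ G' with one additional arc (root of the first copy, root of the second copy):
-- F(j) ⊔ F'(j) plus the arc (u_j , v_j). inj₁ = u-copy, inj₂ = v-copy.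
DoubleArc : (t j : ℕ) → FVertex t j ⊎ FVertex t j → FVertex t j ⊎ FVertex t j → Set
DoubleArc t j (inj₁ x) (inj₁ y) = FArc t j x y
DoubleArc t j (inj₂ x) (inj₂ y) = FArc t j x y
DoubleArc t j (inj₁ x) (inj₂ y) = IsRoot x × IsRoot y
DoubleArc t j (inj₂ x) (inj₁ y) = ⊥

Double : (t j : ℕ) → Digraph
Double t j = record { Vertex = FVertex t j ⊎ FVertex t j ; Arc = DoubleArc t j }

module Submission where

open import Defs
open import Data.Nat using (ℕ; suc; zero; _≤_; _∸_; _+_; s≤s; z≤n)
open import Data.Nat.Properties using (+-suc; ≤-irrelevant; ≤-trans; ≤-reflexive; n≤1+n; +-identityʳ)
open import Data.Nat.ListAction using (sum)
open import Data.List using (List; []; _∷_; _++_; [_])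
open import Data.List.Relation.Unary.All as All using (All; []; _∷_)
open import Data.Product using (Σ; _×_; _,_)
open import Data.Sum using (_⊎_; inj₁; inj₂)
open import Function.Bundles using (_⇔_; mk↔ₛ′; mk⇔)
open import Relation.Nullary using (¬_)
open import Relation.Binary.PropositionalEquality using (_≡_; refl; cong; cong₂; subst; subst₂; sym)

-- The vertex u_i^{a_1 a_2 ⋯ a_m} of F(i) corresponds to u_{i+1}^{(a_1 - 1) a_2 ⋯ a_m} if
-- a_1 ≥ 2 and to v_{i+1}^{a_2 ⋯ a_m} if a_1 = 1, while u_i corresponds to u_{i+1}.
-- Appending a letter commutes with this correspondence, except that the arc (u_i, u_i^1)
-- becomes the extra arc (u_{i+1}, v_{i+1}).

mk≅ₛ′ : ∀ {G H} (to : Vertex G → Vertex H) (from : Vertex H → Vertex G) →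
        (∀ y → to (from y) ≡ y) → (∀ x → from (to x) ≡ x) →
        (∀ x y → Arc G (from x) (from y) ⇔ Arc H x y) → G ≅ H
mk≅ₛ′ {G} {H} to from to∘from from∘to from-arc = record
  { bij      = mk↔ₛ′ to from to∘from from∘to
  ; arc-pres = λ x y → subst₂ (λ a b → Arc G a b ⇔ Arc H (to x) (to y))
                              (from∘to x) (from∘to y) (from-arc (to x) (to y))
  }

Positive : List ℕ → Set
Positive = All (λ a → 1 ≤ a)

FVertex-≡ : ∀ {t i} {x y : FVertex t i} → word x ≡ word y → x ≡ y
FVertex-≡ {x = fv w p b} {y = fv .w q c} refl =
  cong₂ (fv w) (All.irrelevant ≤-irrelevant p q) (≤-irrelevant b c)

Child : List ℕ → List ℕ → Set
Child u v = Σ ℕ λ j → 1 ≤ j × v ≡ u ++ [ j ]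

incHead : List ℕ → List ℕ
incHead []      = []
incHead (a ∷ w) = suc a ∷ w

incHead-positive : ∀ {w} → Positive w → Positive (incHead w)
incHead-positive []       = []
incHead-positive (_ ∷ ps) = s≤s z≤n ∷ ps

+-sum-incHead≤ : ∀ i w → i + sum (incHead w) ≤ suc i + sum w
+-sum-incHead≤ i []      = n≤1+n (i + 0)
+-sum-incHead≤ i (a ∷ w) = ≤-reflexive (+-suc i (a + sum w))

Child-incHead⇔ : ∀ {u v} → Positive v → Child (incHead u) (incHead v) ⇔ Child u v
Child-incHead⇔ {[]} {[]} _ = mk⇔ (λ { (_ , _ , ()) }) (λ { (_ , _ , ()) })
Child-incHead⇔ {[]} {a ∷ []} (1≤a ∷ []) =
  mk⇔ (λ { (_ , _ , refl) → a , 1≤a , refl }) (λ { (_ , _ , refl) → suc a , s≤s z≤n , refl })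
Child-incHead⇔ {[]} {a ∷ b ∷ v} _ = mk⇔ (λ { (_ , _ , ()) }) (λ { (_ , _ , ()) })
Child-incHead⇔ {a ∷ u} {[]} _ = mk⇔ (λ { (_ , _ , ()) }) (λ { (_ , _ , ()) })
Child-incHead⇔ {a ∷ u} {b ∷ v} _ =
  mk⇔ (λ { (j , 1≤j , refl) → j , 1≤j , refl }) (λ { (j , 1≤j , refl) → j , 1≤j , refl })

Child-∷⇔ : ∀ {a u v} → Child (a ∷ u) (a ∷ v) ⇔ Child u v
Child-∷⇔ = mk⇔ (λ { (j , 1≤j , refl) → j , 1≤j , refl }) (λ { (j , 1≤j , refl) → j , 1≤j , refl })

Child-incHead-1∷⇔ : ∀ {u v} → Positive u → Child (incHead u) (1 ∷ v) ⇔ (u ≡ [] × v ≡ [])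
Child-incHead-1∷⇔ {[]} _ = mk⇔ (λ { (_ , _ , refl) → refl , refl }) (λ { (refl , refl) → 1 , s≤s z≤n , refl })
Child-incHead-1∷⇔ {zero ∷ u} (() ∷ _)
Child-incHead-1∷⇔ {suc a ∷ u} _ = mk⇔ (λ { (_ , _ , ()) }) (λ { (() , _) })

¬Child-1∷-incHead : ∀ {u v} → Positive v → ¬ Child (1 ∷ u) (incHead v)
¬Child-1∷-incHead {v = []}        _ (_ , _ , ())
¬Child-1∷-incHead {v = zero ∷ v}  (() ∷ _)
¬Child-1∷-incHead {v = suc a ∷ v} _ (_ , _ , ())

module Splitting (t i : ℕ) (root-bound : suc i ≤ t ∸ 1) where

  merge : FVertex t (suc i) ⊎ FVertex t (suc i) → FVertex t i
  merge (inj₁ (fv w p b)) = fv (incHead w) (incHead-positive p) (≤-trans (+-sum-incHead≤ i w) b)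
  merge (inj₂ (fv w p b)) = fv (1 ∷ w) (s≤s z≤n ∷ p) (subst (_≤ t ∸ 1) (sym (+-suc i (sum w))) b)

  split : FVertex t i → FVertex t (suc i) ⊎ FVertex t (suc i)
  split (fv [] _ _) = inj₁ (fv [] [] (subst (_≤ t ∸ 1) (sym (+-identityʳ (suc i))) root-bound))
  split (fv (1 ∷ w) (_ ∷ p) b) = inj₂ (fv w p (subst (_≤ t ∸ 1) (+-suc i (sum w)) b))
  split (fv (suc (suc a) ∷ w) (_ ∷ p) b) =
    inj₁ (fv (suc a ∷ w) (s≤s z≤n ∷ p) (subst (_≤ t ∸ 1) (+-suc i (suc a + sum w)) b))

  merge-split : ∀ x → merge (split x) ≡ x
  merge-split (fv [] [] _)                     = FVertex-≡ refl
  merge-split (fv (1 ∷ w) (_ ∷ _) _)           = FVertex-≡ refl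
  merge-split (fv (suc (suc a) ∷ w) (_ ∷ _) _) = FVertex-≡ refl

  split-merge : ∀ y → split (merge y) ≡ y
  split-merge (inj₁ (fv [] [] _))               = cong inj₁ (FVertex-≡ refl)
  split-merge (inj₁ (fv (zero ∷ w) (() ∷ _) _))
  split-merge (inj₁ (fv (suc a ∷ w) (_ ∷ _) _)) = cong inj₁ (FVertex-≡ refl)
  split-merge (inj₂ (fv w _ _))                 = cong inj₂ (FVertex-≡ refl)

  merge-arc : ∀ x y → FArc t i (merge x) (merge y) ⇔ DoubleArc t (suc i) x y
  merge-arc (inj₁ x) (inj₁ y) = Child-incHead⇔ (pos y)
  merge-arc (inj₁ x) (inj₂ y) = Child-incHead-1∷⇔ (pos x)
  merge-arc (inj₂ x) (inj₁ y) = mk⇔ (¬Child-1∷-incHead (pos y)) (λ ())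
  merge-arc (inj₂ x) (inj₂ y) = Child-∷⇔

lemma6 : (t i : ℕ) → 3 ≤ t → 1 ≤ i → i ≤ t ∸ 2 → F t i ≅ Double t (suc i)
lemma6 t i (s≤s (s≤s (s≤s _))) _ i≤t∸2 = mk≅ₛ′ split merge split-merge merge-split merge-arc
  where open Splitting t i (s≤s i≤t∸2)
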